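{- Let $\mathfrak{G}$ be an alphabet, $\mathcal{P}\subseteq\mathbf{S}(\mathfrak{G})\setminus\{\perp\}$, and $\mathtt{a}\in\mathfrak{G}(k)$. If $\mathcal{P}_\mathtt{a}$ is finite, then the set of all minimal $\mathcal{P}_\mathtt{a}$-consistent words is finite and its cardinality is at most $k^{\#\mathcal{P}_\mathtt{a}}$.
   Context: An alphabet is a graded set $\mathfrak{G}=\bigsqcup_{n\ge1}\mathfrak{G}(n)$. A $\mathfrak{G}$-tree is a planar rooted tree whose internal nodes of arity $k$ are labeled by letters of $\mathfrak{G}(k)$; $\mathbf{S}(\mathfrak{G})$ is their set; $\perp$ is the one-leaf tree; if the root has arity $k$, $\mathfrak{t}(i)$ is the subtree rooted at its $i$th child. $\mathcal{P}_\mathtt{a}$ is the set of trees of $\mathcal{P}$ whose root is labeled $\mathtt{a}$. A word $(\mathcal{S}_1,\dots,\mathcal{S}_k)$ of subsets of $\mathbf{S}(\mathfrak{G})$ is $\mathcal{P}_\mathtt{a}$-consistent if for every $\mathfrak{s}\in\mathcal{P}_\mathtt{a}$ there is $i\in[k]$ with $\mathfrak{s}(i)\ne\perp$ and $\mathfrak{s}(i)\in\mathcal{S}_i$. With $(\mathcal{S}_1,\dots,\mathcal{S}_k)\oplus(\mathcal{S}'_1,\dots,\mathcal{S}'_k):=(\mathcal{S}_1\cup\mathcal{S}'_1,\dots,\mathcal{S}_k\cup\mathcal{S}'_k)$, a $\mathcal{P}_\mathtt{a}$-consistent word $\mathcal{S}$ is minimal if any decomposition $\mathcal{S}=\mathcal{S}'\oplus\mathcal{S}''$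 with $\mathcal{S}'$ $\mathcal{P}_\mathtt{a}$-consistent forces $\mathcal{S}=\mathcal{S}'$. -}

module Defs where

open import Data.Nat using (ℕ; _^_; _≤_)
open import Data.Fin using (Fin)
open import Data.List using (List; length)
open import Data.List.Membership.Propositional using (_∈_)
open import Data.List.Relation.Unary.Unique.Propositional using (Unique)
open import Data.List.Relation.Unary.Any using (Any)
open import Data.Product using (Σ; _×_; ∃-syntax)
open import Data.Sum using (_⊎_)
open import Data.Empty using (⊥)
open import Relation.Nullary using (¬_)
open import Relation.Binary.PropositionalEquality using (_≡_; _≢_)
open import Function.Bundles using (_⇔_)

record Alphabet : Set₁ where
  field
    Letter    : ℕ → Set
    noNullary : ¬ Letter 0

open Alphabet public

-- 𝔊-trees: planar rooted trees, internal nodes of arity k labelled by 𝔊(k).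
-- 'leaf' is the one-leaf tree ⊥; 'node a ch' has root labelled a and
-- ch i is the subtree 𝔱(i) rooted at its i-th child.
data Tree (𝔊 : Alphabet) : Set where
  leaf : Tree 𝔊
  node : {k : ℕ} → Letter 𝔊 k → (Fin k → Tree 𝔊) → Tree 𝔊

TreeSet : Alphabet → Set₁
TreeSet 𝔊 = Tree 𝔊 → Set

RootedAt : {𝔊 : Alphabet} {k : ℕ} → TreeSet 𝔊 → Letter 𝔊 k → TreeSet 𝔊
RootedAt {𝔊} {k} P a t = Σ (Fin k → Tree 𝔊) λ ch → (t ≡ node a ch) × P t

FiniteWithCard : {𝔊 : Alphabet} → TreeSet 𝔊 → ℕ → Set
FiniteWithCard {𝔊} Q n =
  Σ (List (Tree 𝔊)) λ L → Unique L × (length L ≡ n) × ((t : Tree 𝔊) → Q t ⇔ (t ∈ L))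

Word : Alphabet → ℕ → Set₁
Word 𝔊 k = Fin k → TreeSet 𝔊

_≐_ : {𝔊 : Alphabet} {k : ℕ} → Word 𝔊 k → Word 𝔊 k → Set
_≐_ {𝔊} {k} S S′ = (i : Fin k) (t : Tree 𝔊) → S i t ⇔ S′ i t

IsSum : {𝔊 : Alphabet} {k : ℕ} → Word 𝔊 k → Word 𝔊 k → Word 𝔊 k → Set
IsSum {𝔊} {k} S S′ S″ = (i : Fin k) (t : Tree 𝔊) → S i t ⇔ (S′ i t ⊎ S″ i t)

Consistent : {𝔊 : Alphabet} {k : ℕ} → TreeSet 𝔊 → Letter 𝔊 k → Word 𝔊 k → Set
Consistent {𝔊} {k} P a S =
  (ch : Fin k → Tree 𝔊) → RootedAt P a (node a ch) →
  ∃[ i ] ((ch i ≢ leaf) × S i (ch i))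

MinimalConsistent : {𝔊 : Alphabet} {k : ℕ} → TreeSet 𝔊 → Letter 𝔊 k → Word 𝔊 k → Set₁
MinimalConsistent {𝔊} {k} P a S =
  Consistent P a S ×
  ((S′ S″ : Word 𝔊 k) → IsSum S S′ S″ → Consistent P a S′ → S ≐ S′)

module Submission where

-- Enumerate 𝒫_a as 𝔰₀, …, 𝔰_{n-1}.  A 𝒫_a-consistent word S
-- provides, for every j, an index v(j) ∈ [k] such that 𝔰_j(v(j)) ≠ ⊥ and
-- 𝔰_j(v(j)) ∈ S_{v(j)}; this "witness vector" v lies in [k]ⁿ.  Every vector v
-- determines the choice word W(v), whose i-th letter is { 𝔰_j(i) : v(j) = i }.
-- By construction W(v) ⊆ S and S ∩ W(v) is still consistent.  Minimality of S
-- then forces S ⊆ W(v) (a minimal consistent word is contained in every word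
-- whose intersection with it stays consistent), hence S = W(v).  So the map
-- v ↦ W(v), applied to the kⁿ vectors of [k]ⁿ, lists every minimal consistent
-- word.

open import Defs
open import Data.Nat using (ℕ; zero; suc; _+_; _*_; _^_; _≤_)
open import Data.Nat.Properties using (≤-reflexive)
open import Data.Fin using (Fin)
open import Data.Vec using (Vec; []; _∷_; lookup; tabulate)
open import Data.Vec.Properties using (lookup∘tabulate)
import Data.List as List
open import Data.List using (List; []; _∷_; length; map; allFin; cartesianProductWith)
open import Data.List.Properties using (length-++; length-map; length-tabulate)
open import Data.List.Membership.Propositional using (_∈_)
open import Data.List.Membership.Propositional.Properties using (∈-allFin; ∈-lookup)
open import Data.List.Relation.Unary.Any using (Any; here; index)
import Data.List.Relation.Unary.Any as Any
open import Data.List.Relation.Unary.Any.Properties using (lookup-index; map⁺; cartesianProductWith⁺)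
open import Data.Product using (Σ; _×_; _,_; proj₁; proj₂; ∃-syntax)
open import Data.Sum using (inj₂; [_,_])
open import Data.Empty using (⊥)
open import Function using (id)
open import Function.Bundles using (Equivalence; mk⇔; _⇔_)
open import Relation.Binary.PropositionalEquality
  using (_≡_; _≢_; refl; sym; trans; cong; cong₂; subst; module ≡-Reasoning)

module _ {A : Set} where

  allVectors : List A → (n : ℕ) → List (Vec A n)
  allVectors xs zero    = [] ∷ []
  allVectors xs (suc n) = cartesianProductWith _∷_ xs (allVectors xs n)

  length-cartesianProductWith : {B C : Set} (f : A → B → C) (xs : List A) (ys : List B) →
    length (cartesianProductWith f xs ys) ≡ length xs * length ys
  length-cartesianProductWith f []       ys = refl
  length-cartesianProductWith f (x ∷ xs) ys = trans (length-++ (map (f x) ys))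
    (cong₂ _+_ (length-map (f x) ys) (length-cartesianProductWith f xs ys))

  length-allVectors : (xs : List A) (n : ℕ) → length (allVectors xs n) ≡ length xs ^ n
  length-allVectors xs zero    = refl
  length-allVectors xs (suc n) =
    trans (length-cartesianProductWith _∷_ xs (allVectors xs n))
          (cong (length xs *_) (length-allVectors xs n))

  ∈-allVectors : {xs : List A} → ((x : A) → x ∈ xs) → {n : ℕ} (v : Vec A n) →
    v ∈ allVectors xs n
  ∈-allVectors complete []      = here refl
  ∈-allVectors complete (x ∷ v) =
    cartesianProductWith⁺ _∷_ (cong₂ _∷_) (complete x) (∈-allVectors complete v)

module _ {𝔊 : Alphabet} {k : ℕ} where

  _∩_ : Word 𝔊 k → Word 𝔊 k → Word 𝔊 k
  (S ∩ T) i t = S i t × T i t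

  _⊆_ : Word 𝔊 k → Word 𝔊 k → Set
  S ⊆ T = (i : Fin k) (t : Tree 𝔊) → S i t → T i t

  -- A minimal consistent word lies inside every word T for which S ∩ T is
  -- still consistent: S = (S ∩ T) ⊕ S, so minimality gives S = S ∩ T.
  minimal-⊆ : {P : TreeSet 𝔊} {a : Letter 𝔊 k} {S : Word 𝔊 k} (T : Word 𝔊 k) →
    MinimalConsistent P a S → Consistent P a (S ∩ T) → S ⊆ T
  minimal-⊆ {S = S} T (_ , minimal) consistent∩ i t s =
    proj₂ (Equivalence.to (S≐S∩T i t) s)
    where
    S≐S∩T : S ≐ (S ∩ T)
    S≐S∩T = minimal (S ∩ T) S (λ i t → mk⇔ inj₂ [ proj₁ , id ]) consistent∩

node-injective : {𝔊 : Alphabet} {k : ℕ} {a : Letter 𝔊 k} {c d : Fin k → Tree 𝔊} →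
  node a c ≡ node a d → c ≡ d
node-injective refl = refl

module ChoiceWords {𝔊 : Alphabet} (P : TreeSet 𝔊) {k : ℕ} (a : Letter 𝔊 k)
  (Ls : List (Tree 𝔊)) (enumerates : (t : Tree 𝔊) → RootedAt P a t ⇔ (t ∈ Ls)) where

  private
    n : ℕ
    n = length Ls

    rootedAt : (j : Fin n) → RootedAt P a (List.lookup Ls j)
    rootedAt j = Equivalence.from (enumerates _) (∈-lookup j)

  children : Fin n → Fin k → Tree 𝔊
  children j = proj₁ (rootedAt j)

  lookup≡node : (j : Fin n) → List.lookup Ls j ≡ node a (children j)
  lookup≡node j = proj₁ (proj₂ (rootedAt j))

  children-rootedAt : (j : Fin n) → RootedAt P a (node a (children j))
  children-rootedAt j =
    children j , refl , subst P (lookup≡node j) (proj₂ (proj₂ (rootedAt j)))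

  indexOf : {ch : Fin k → Tree 𝔊} → RootedAt P a (node a ch) →
    ∃[ j ] (children j ≡ ch)
  indexOf {ch} r = index mem ,
    sym (node-injective (trans (lookup-index mem) (lookup≡node (index mem))))
    where
    mem : node a ch ∈ Ls
    mem = Equivalence.to (enumerates _) r

  ChoiceWord : Vec (Fin k) n → Word 𝔊 k
  ChoiceWord v i t = ∃[ j ] ((lookup v j ≡ i) × (t ≡ children j i))

  module _ {S : Word 𝔊 k} (consistent : Consistent P a S) where

    private
      witness : (j : Fin n) → ∃[ i ] ((children j i ≢ leaf) × S i (children j i))
      witness j = consistent (children j) (children-rootedAt j)

    witnesses : Vec (Fin k) n
    witnesses = tabulate (λ j → proj₁ (witness j))

    -- Each 𝔰_j(v(j)) was chosen inside S_{v(j)}, so the choice word lies in S.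
    choiceWord-⊆ : ChoiceWord witnesses ⊆ S
    choiceWord-⊆ i t (j , refl , refl) =
      subst (λ i → S i (children j i)) (sym (lookup∘tabulate _ j)) (proj₂ (proj₂ (witness j)))

    -- Restricting S to its choice word keeps the witnesses, hence consistency.
    choiceWord-consistent : Consistent P a (S ∩ ChoiceWord witnesses)
    choiceWord-consistent ch r with indexOf r
    ... | j , refl =
      let i , nonLeaf , s = witness j in
      i , nonLeaf , s , j , lookup∘tabulate _ j , refl

  minimal≐choiceWord : {S : Word 𝔊 k} (minimal : MinimalConsistent P a S) →
    S ≐ ChoiceWord (witnesses {S} (proj₁ minimal))
  minimal≐choiceWord {S} minimal@(consistent , _) i t = mk⇔
    (minimal-⊆ {P = P} {a} {S} (ChoiceWord (witnesses {S} consistent)) minimal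
      (choiceWord-consistent {S} consistent) i t)
    (choiceWord-⊆ {S} consistent i t)

lemma2p3p1 : (𝔊 : Alphabet) (P : TreeSet 𝔊) → (P leaf → ⊥) →
    (k : ℕ) (a : Letter 𝔊 k) (n : ℕ) → FiniteWithCard (RootedAt P a) n →
    Σ (List (Word 𝔊 k)) λ Ws →
    ((S : Word 𝔊 k) → MinimalConsistent P a S → Any (S ≐_) Ws) ×
    (length Ws ≤ k ^ n)
lemma2p3p1 𝔊 P _ k a .(length Ls) (Ls , _ , refl , enumerates) =
  map ChoiceWord vectors , covers , ≤-reflexive size
  where
  open ChoiceWords P a Ls enumerates

  vectors : List (Vec (Fin k) (length Ls))
  vectors = allVectors (allFin k) (length Ls)

  covers : (S : Word 𝔊 k) → MinimalConsistent P a S → Any (S ≐_) (map ChoiceWord vectors)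
  covers S minimal = map⁺ (Any.map (λ { refl → minimal≐choiceWord minimal })
    (∈-allVectors ∈-allFin (witnesses {S} (proj₁ minimal))))

  size : length (map ChoiceWord vectors) ≡ k ^ length Ls
  size = begin
    length (map ChoiceWord vectors)  ≡⟨ length-map ChoiceWord vectors ⟩
    length vectors                   ≡⟨ length-allVectors (allFin k) (length Ls) ⟩
    length (allFin k) ^ length Ls    ≡⟨ cong (_^ length Ls) (length-tabulate id) ⟩
    k ^ length Ls                    ∎
    where open ≡-Reasoning
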